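{- Let $\Gamma,\Delta$ be finite multisets of $2$PC formulas. If $\Gamma\vdash_2\Delta$ is provable in $2$PC, then $(\Gamma^{(12)})^\bullet\vdash(\Delta^{(12)})^\bullet$ is provable in the PC sequent calculus.
   Context: $2$PC: formulas are decorated variables $X^{id},X^{(12)}$ ($X\in V$, $V$ a countable set of variables, $S_2=\{id,(12)\}$), constants $\mathsf e_1,\mathsf e_2$, and $q(F,G_1,G_2)$. For $\rho\in S_2$: $(X^\pi)^\rho=X^{\rho\circ\pi}$, $(\mathsf e_k)^\rho=\mathsf e_{\rho(k)}$, $q(F,G_1,G_2)^\rho=q(F,G_1^\rho,G_2^\rho)$; $(ij)$ is the transposition of $i,j$ (identity if $i=j$); $\Gamma^\rho$ elementwise. Sequents $\Gamma\vdash_i\Delta$ ($i\in\{1,2\}$) are provable if derivable by (premises $\Rightarrow$ conclusion), for all $i,j,k\in\{1,2\}$: (Const) $\Rightarrow\vdash_i\mathsf e_i$; (Id) $\Rightarrow X^\pi\vdash_i X^\rho$ if $\pi^{ -1}(i)=\rho^{ -1}(i)$; (Sym) $\Gamma^{(ij)}\vdash_i\Delta^{(ij)}\Rightarrow\Gamma\vdash_j\Delta$; (Neg1) if $i\neq k$: $\Gamma^{(ij)}\vdash_iF,\Delta^{(ij)}\Rightarrow\Gamma,F^{(jk)}\vdash_j\Delta$; (Neg2) if $j\neq k$: $\Gamma^{(ij)}\vdash_iF,\Delta^{(ij)}\Rightarrow\Gamma,F^{(ik)}\vdash_j\Delta$; (Neg3) $\{\Gamma^{(ij)},F\vdash_i\Delta^{(ij)}\}_{i\ne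 j}\Rightarrow\Gamma\vdash_jF,\Delta$; (qL) $\{\Gamma^{(ji)},F,G_j^{(ji)}\vdash_j\Delta^{(ji)}\}_{j\in\{1,2\}}\Rightarrow\Gamma,q(F,G_1,G_2)\vdash_i\Delta$; (qR) $\{\Gamma^{(ji)},F\vdash_jG_j^{(ji)},\Delta^{(ji)}\}_{j\in\{1,2\}}\Rightarrow\Gamma\vdash_iq(F,G_1,G_2),\Delta$; Cut, weakening and contraction on both sides. PC: formulas built from $0,1$, variables in $V$, $\neg,\wedge,\vee$. The PC sequent calculus has rules: $\Rightarrow\ \vdash 1$; $\Rightarrow 0\vdash$; $\Rightarrow P\vdash P$; $\Gamma,P,Q\vdash\Delta\Rightarrow\Gamma,P\wedge Q\vdash\Delta$; $\Gamma\vdash P,\Delta$ and $\Gamma\vdash Q,\Delta\Rightarrow\Gamma\vdash P\wedge Q,\Delta$; $\Gamma,P\vdash\Delta$ and $\Gamma,Q\vdash\Delta\Rightarrow\Gamma,P\vee Q\vdash\Delta$; $\Gamma\vdash P,Q,\Delta\Rightarrow\Gamma\vdash P\vee Q,\Delta$; $\Gamma\vdash P,\Delta\Rightarrow\Gamma,\neg P\vdash\Delta$; $\Gamma,P\vdash\Delta\Rightarrow\Gamma\vdash\neg P,\Delta$; Cut, weakening and contraction on both sides. Translation $\bullet$ from $2$PC to PC: $\mathsf e_2^\bullet=0$, $\mathsf e_1^\bullet=1$, $(X^{id})^\bullet=X$, $(X^{(12)})^\bullet=\neg X$, $q(F,G,H)^\bullet=(F^\bullet\wedge G^\bullet)\vee(\neg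 F^\bullet\wedge H^\bullet)$, extended elementwise. -}

module Defs where

open import Data.Nat using (ℕ)
open import Data.List using (List; []; _∷_; map)
open import Data.List.Relation.Binary.Permutation.Propositional using (_↭_)
open import Relation.Binary.PropositionalEquality using (_≡_; _≢_)

Var : Set
Var = ℕ

data Two : Set where
  one two : Two

data S2 : Set where
  ι : S2
  τ : S2

app : S2 → Two → Two
app ι k = k
app τ one = two
app τ two = one

_∘ₛ_ : S2 → S2 → S2
ι ∘ₛ π = π
τ ∘ₛ ι = τ
τ ∘ₛ τ = ι

inv : S2 → S2
inv ι = ι
inv τ = τ

-- transposition (i j); identity if i = j
tr : Two → Two → S2
tr one one = ι
tr one two = τ
tr two one = τ
tr two two = ι

data F2 : Set where
  var : Var → S2 → F2
  e   : Two → F2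
  q   : F2 → F2 → F2 → F2

act : F2 → S2 → F2
act (var X π) ρ = var X (ρ ∘ₛ π)
act (e k) ρ = e (app ρ k)
act (q F G₁ G₂) ρ = q F (act G₁ ρ) (act G₂ ρ)

actL : List F2 → S2 → List F2
actL Γ ρ = map (λ F → act F ρ) Γ

sel : Two → F2 → F2 → F2
sel one G₁ G₂ = G₁
sel two G₁ G₂ = G₂

-- Provability of 2PC sequents Γ ⊢ᵢ Δ.  Finite multisets are represented
-- by lists, together with an exchange rule (permutation on each side).
-- "Γ, F" is written F ∷ Γ.
infix 4 _⊢[_]_
data _⊢[_]_ : List F2 → Two → List F2 → Set where
  Const : ∀ {i} → [] ⊢[ i ] (e i ∷ [])
  Id    : ∀ {i X π ρ} → app (inv π) i ≡ app (inv ρ) i →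
          (var X π ∷ []) ⊢[ i ] (var X ρ ∷ [])
  Sym   : ∀ {Γ Δ i j} →
          actL Γ (tr i j) ⊢[ i ] actL Δ (tr i j) →
          Γ ⊢[ j ] Δ
  Neg1  : ∀ {Γ Δ F i j k} → i ≢ k →
          actL Γ (tr i j) ⊢[ i ] (F ∷ actL Δ (tr i j)) →
          (act F (tr j k) ∷ Γ) ⊢[ j ] Δ
  Neg2  : ∀ {Γ Δ F i j k} → j ≢ k →
          actL Γ (tr i j) ⊢[ i ] (F ∷ actL Δ (tr i j)) →
          (act F (tr i k) ∷ Γ) ⊢[ j ] Δ
  Neg3  : ∀ {Γ Δ F i j} → i ≢ j →
          (F ∷ actL Γ (tr i j)) ⊢[ i ] actL Δ (tr i j) →
          Γ ⊢[ j ] (F ∷ Δ)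
  qL    : ∀ {Γ Δ F G₁ G₂ i} →
          (∀ j → (act (sel j G₁ G₂) (tr j i) ∷ F ∷ actL Γ (tr j i))
                   ⊢[ j ] actL Δ (tr j i)) →
          (q F G₁ G₂ ∷ Γ) ⊢[ i ] Δ
  qR    : ∀ {Γ Δ F G₁ G₂ i} →
          (∀ j → (F ∷ actL Γ (tr j i))
                   ⊢[ j ] (act (sel j G₁ G₂) (tr j i) ∷ actL Δ (tr j i))) →
          Γ ⊢[ i ] (q F G₁ G₂ ∷ Δ)
  Cut   : ∀ {Γ Δ F i} →
          Γ ⊢[ i ] (F ∷ Δ) → (F ∷ Γ) ⊢[ i ] Δ → Γ ⊢[ i ] Δ
  WkL   : ∀ {Γ Δ F i} → Γ ⊢[ i ] Δ → (F ∷ Γ) ⊢[ i ] Δ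
  WkR   : ∀ {Γ Δ F i} → Γ ⊢[ i ] Δ → Γ ⊢[ i ] (F ∷ Δ)
  CtrL  : ∀ {Γ Δ F i} → (F ∷ F ∷ Γ) ⊢[ i ] Δ → (F ∷ Γ) ⊢[ i ] Δ
  CtrR  : ∀ {Γ Δ F i} → Γ ⊢[ i ] (F ∷ F ∷ Δ) → Γ ⊢[ i ] (F ∷ Δ)
  Exch  : ∀ {Γ Γ' Δ Δ' i} → Γ ↭ Γ' → Δ ↭ Δ' →
          Γ ⊢[ i ] Δ → Γ' ⊢[ i ] Δ'

data PF : Set where
  𝟘 𝟙  : PF
  pv   : Var → PF
  ¬ₚ_  : PF → PF
  _∧ₚ_ : PF → PF → PF
  _∨ₚ_ : PF → PF → PF

infix 4 _⊢ₚ_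
data _⊢ₚ_ : List PF → List PF → Set where
  oneR : [] ⊢ₚ (𝟙 ∷ [])
  zeroL : (𝟘 ∷ []) ⊢ₚ []
  ax   : ∀ {P} → (P ∷ []) ⊢ₚ (P ∷ [])
  ∧L   : ∀ {Γ Δ P Q} → (P ∷ Q ∷ Γ) ⊢ₚ Δ → ((P ∧ₚ Q) ∷ Γ) ⊢ₚ Δ
  ∧R   : ∀ {Γ Δ P Q} → Γ ⊢ₚ (P ∷ Δ) → Γ ⊢ₚ (Q ∷ Δ) → Γ ⊢ₚ ((P ∧ₚ Q) ∷ Δ)
  ∨L   : ∀ {Γ Δ P Q} → (P ∷ Γ) ⊢ₚ Δ → (Q ∷ Γ) ⊢ₚ Δ → ((P ∨ₚ Q) ∷ Γ) ⊢ₚ Δ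
  ∨R   : ∀ {Γ Δ P Q} → Γ ⊢ₚ (P ∷ Q ∷ Δ) → Γ ⊢ₚ ((P ∨ₚ Q) ∷ Δ)
  ¬L   : ∀ {Γ Δ P} → Γ ⊢ₚ (P ∷ Δ) → ((¬ₚ P) ∷ Γ) ⊢ₚ Δ
  ¬R   : ∀ {Γ Δ P} → (P ∷ Γ) ⊢ₚ Δ → Γ ⊢ₚ ((¬ₚ P) ∷ Δ)
  cut  : ∀ {Γ Δ P} → Γ ⊢ₚ (P ∷ Δ) → (P ∷ Γ) ⊢ₚ Δ → Γ ⊢ₚ Δ
  wkL  : ∀ {Γ Δ P} → Γ ⊢ₚ Δ → (P ∷ Γ) ⊢ₚ Δ
  wkR  : ∀ {Γ Δ P} → Γ ⊢ₚ Δ → Γ ⊢ₚ (P ∷ Δ)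
  ctrL : ∀ {Γ Δ P} → (P ∷ P ∷ Γ) ⊢ₚ Δ → (P ∷ Γ) ⊢ₚ Δ
  ctrR : ∀ {Γ Δ P} → Γ ⊢ₚ (P ∷ P ∷ Δ) → Γ ⊢ₚ (P ∷ Δ)
  exch : ∀ {Γ Γ' Δ Δ'} → Γ ↭ Γ' → Δ ↭ Δ' → Γ ⊢ₚ Δ → Γ' ⊢ₚ Δ'

infix 30 _•
_• : F2 → PF
e two • = 𝟘
e one • = 𝟙
var X ι • = pv X
var X τ • = ¬ₚ pv X
q F G H • = ((F •) ∧ₚ (G •)) ∨ₚ ((¬ₚ (F •)) ∧ₚ (H •))

infix 30 _•L
_•L : List F2 → List PF
Γ •L = map _• Γ

-- A sequent at index i is read classically after the permutation (i 1), which moves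
-- position i to position 1; at i = 2 this is (12). Under this reading X^(12) is ¬X,
-- acting by (12) on any formula negates its translation up to PC-equivalence, and
-- q(F,G₁,G₂) is the conditional "if F then G₁ else G₂". The three negation rules
-- then become ¬L and ¬R, the q-rules become case distinctions on F, and the
-- reindexing of contexts in the premises is absorbed by (i 1) ∘ (i j) = (j 1).
module Submission where

open import Defs
open import Data.List using (List; []; _∷_)
open import Data.List.Membership.Propositional using (_∈_)
open import Data.List.Relation.Unary.Any using (here; there)
open import Data.List.Relation.Binary.Subset.Propositional using (_⊆_)
open import Data.List.Relation.Binary.Permutation.Propositional using (↭-refl; ↭-swap)
open import Data.List.Relation.Binary.Permutation.Propositional.Properties using (map⁺)
open import Relation.Nullary using (contradiction)
open import Relation.Binary.PropositionalEquality
  using (_≡_; _≢_; refl; sym; trans; cong; cong₂; subst₂)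

∘ₛ-assoc : ∀ a b c → (a ∘ₛ b) ∘ₛ c ≡ a ∘ₛ (b ∘ₛ c)
∘ₛ-assoc ι b c = refl
∘ₛ-assoc τ ι c = refl
∘ₛ-assoc τ τ ι = refl
∘ₛ-assoc τ τ τ = refl

app-∘ₛ : ∀ a b k → app (a ∘ₛ b) k ≡ app a (app b k)
app-∘ₛ ι b k = refl
app-∘ₛ τ ι k = refl
app-∘ₛ τ τ one = refl
app-∘ₛ τ τ two = refl

≡-at-inv⇒≡ : ∀ i π ρ → app (inv π) i ≡ app (inv ρ) i → π ≡ ρ
≡-at-inv⇒≡ i ι ι _ = refl
≡-at-inv⇒≡ i τ τ _ = refl
≡-at-inv⇒≡ one ι τ ()
≡-at-inv⇒≡ two ι τ ()
≡-at-inv⇒≡ one τ ι ()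
≡-at-inv⇒≡ two τ ι ()

act-ι : ∀ F → act F ι ≡ F
act-ι (var X π) = refl
act-ι (e k) = refl
act-ι (q F G H) = cong₂ (q F) (act-ι G) (act-ι H)

act-act : ∀ F r s → act (act F r) s ≡ act F (s ∘ₛ r)
act-act (var X π) r s = cong (var X) (sym (∘ₛ-assoc s r π))
act-act (e k) r s = cong e (sym (app-∘ₛ s r k))
act-act (q F G H) r s = cong₂ (q F) (act-act G r s) (act-act H r s)

act-act-≡ : ∀ F {r s r′ s′} → s ∘ₛ r ≡ s′ ∘ₛ r′ →
            act (act F r) s ≡ act (act F r′) s′
act-act-≡ F {r} {s} {r′} {s′} eq =
  trans (act-act F r s) (trans (cong (act F) eq) (sym (act-act F r′ s′)))

to₁ : Two → S2
to₁ i = tr i one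

to₁-tr : ∀ i j → to₁ i ∘ₛ tr i j ≡ to₁ j
to₁-tr one one = refl
to₁-tr one two = refl
to₁-tr two one = refl
to₁-tr two two = refl

to₁-≢ : ∀ i j → i ≢ j → to₁ j ≡ τ ∘ₛ to₁ i
to₁-≢ one two _ = refl
to₁-≢ two one _ = refl
to₁-≢ one one i≢j = contradiction refl i≢j
to₁-≢ two two i≢j = contradiction refl i≢j

to₁-tr-≢ : ∀ i j k → j ≢ k → to₁ j ∘ₛ tr i k ≡ τ ∘ₛ to₁ i
to₁-tr-≢ one one two _ = refl
to₁-tr-≢ one two one _ = refl
to₁-tr-≢ two one two _ = refl
to₁-tr-≢ two two one _ = refl
to₁-tr-≢ _ one one j≢k = contradiction refl j≢k
to₁-tr-≢ _ two two j≢k = contradiction refl j≢k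

wkL* : ∀ {Δ} Γ → [] ⊢ₚ Δ → Γ ⊢ₚ Δ
wkL* [] p = p
wkL* (_ ∷ Γ) p = wkL (wkL* Γ p)

wkR* : ∀ {Γ} Δ → Γ ⊢ₚ [] → Γ ⊢ₚ Δ
wkR* [] p = p
wkR* (_ ∷ Δ) p = wkR (wkR* Δ p)

ax-wk : ∀ {A} Γ Δ → (A ∷ Γ) ⊢ₚ (A ∷ Δ)
ax-wk [] [] = ax
ax-wk [] (B ∷ Δ) = exch ↭-refl (↭-swap _ _ ↭-refl) (wkR (ax-wk [] Δ))
ax-wk (B ∷ Γ) Δ = exch (↭-swap _ _ ↭-refl) ↭-refl (wkL (ax-wk Γ Δ))

at₀ : ∀ {A : PF} {Γ} → A ∈ (A ∷ Γ)
at₀ = here refl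

at₁ : ∀ {A B : PF} {Γ} → A ∈ (B ∷ A ∷ Γ)
at₁ = there at₀

at₂ : ∀ {A B C : PF} {Γ} → A ∈ (C ∷ B ∷ A ∷ Γ)
at₂ = there at₁

∈-axR : ∀ {A Γ Δ} → A ∈ Γ → Γ ⊢ₚ (A ∷ Δ)
∈-axR {Γ = _ ∷ Γ} (here refl) = ax-wk Γ _
∈-axR (there A∈Γ) = wkL (∈-axR A∈Γ)

∈-axL : ∀ {A Γ Δ} → A ∈ Δ → (A ∷ Γ) ⊢ₚ Δ
∈-axL {Δ = _ ∷ Δ} (here refl) = ax-wk _ Δ
∈-axL (there A∈Δ) = wkR (∈-axL A∈Δ)

-- Each formula of Γ is moved to the right as a negation and then cut against its
-- copy in Γ′; this gives weakening, contraction and exchange in one rule.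
⊆-L : ∀ {Γ′ Δ} Γ → Γ ⊆ Γ′ → Γ ⊢ₚ Δ → Γ′ ⊢ₚ Δ
⊆-L [] _ p = wkL* _ p
⊆-L (A ∷ Γ) sub p =
  cut (⊆-L Γ (λ m → sub (there m)) (¬R p)) (¬L (∈-axR (sub at₀)))

⊆-R : ∀ {Γ Δ′} Δ → Δ ⊆ Δ′ → Γ ⊢ₚ Δ → Γ ⊢ₚ Δ′
⊆-R [] _ p = wkR* _ p
⊆-R (A ∷ Δ) sub p =
  cut (¬R (∈-axL (sub at₀))) (⊆-R Δ (λ m → sub (there m)) (¬L p))

∈-ax : ∀ {A Γ Δ} → A ∈ Γ → A ∈ Δ → Γ ⊢ₚ Δ
∈-ax A∈Γ A∈Δ = ⊆-L (_ ∷ []) (λ { (here refl) → A∈Γ }) (∈-axL A∈Δ)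

entail-∈ : ∀ {A B Γ Δ} → (A ∷ []) ⊢ₚ (B ∷ []) → A ∈ Γ → Γ ⊢ₚ (B ∷ Δ)
entail-∈ A⊢B A∈Γ =
  ⊆-L (_ ∷ []) (λ { (here refl) → A∈Γ })
      (⊆-R (_ ∷ []) (λ { (here refl) → at₀ }) A⊢B)

cut-∈ : ∀ {A B Γ Δ} → (A ∷ []) ⊢ₚ (B ∷ []) → A ∈ Γ → (B ∷ Γ) ⊢ₚ Δ → Γ ⊢ₚ Δ
cut-∈ A⊢B A∈Γ = cut (entail-∈ A⊢B A∈Γ)

by-cases : ∀ {A Γ Δ} → (A ∷ Γ) ⊢ₚ Δ → ((¬ₚ A) ∷ Γ) ⊢ₚ Δ → Γ ⊢ₚ Δ
by-cases p r = cut (¬R p) r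

¬∈-R : ∀ {A Γ Δ} → (¬ₚ A) ∈ Γ → Γ ⊢ₚ (A ∷ Δ) → Γ ⊢ₚ Δ
¬∈-R ¬A∈Γ p = ⊆-L _ (λ { (here refl) → ¬A∈Γ ; (there m) → m }) (¬L p)

∈-¬∈ : ∀ {A Γ Δ} → A ∈ Γ → (¬ₚ A) ∈ Γ → Γ ⊢ₚ Δ
∈-¬∈ A∈Γ ¬A∈Γ = ¬∈-R ¬A∈Γ (∈-ax A∈Γ at₀)

∨R₁ : ∀ {Γ Δ P Q} → Γ ⊢ₚ (P ∷ Δ) → Γ ⊢ₚ ((P ∨ₚ Q) ∷ Δ)
∨R₁ p = ∨R (⊆-R _ (λ { (here refl) → at₀ ; (there m) → there (there m) }) p)

∨R₂ : ∀ {Γ Δ P Q} → Γ ⊢ₚ (Q ∷ Δ) → Γ ⊢ₚ ((P ∨ₚ Q) ∷ Δ)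
∨R₂ p = ∨R (⊆-R _ (λ { (here refl) → at₁ ; (there m) → there (there m) }) p)

τ•⊢¬• : ∀ G → ((act G τ) • ∷ []) ⊢ₚ ((¬ₚ (G •)) ∷ [])
τ•⊢¬• (var X ι) = ax
τ•⊢¬• (var X τ) = ¬R (¬L ax)
τ•⊢¬• (e one) = wkR zeroL
τ•⊢¬• (e two) = wkL (¬R zeroL)
τ•⊢¬• (q F G H) =
  ∨L (∧L (¬R (∨L
        (∧L (cut-∈ (τ•⊢¬• G) (there at₂) (¬L (∈-ax at₁ at₀))))
        (∧L (¬L (∈-ax at₁ at₀))))))
     (∧L (¬R (∨L
        (∧L (∈-¬∈ at₀ at₂))
        (∧L (cut-∈ (τ•⊢¬• H) (there at₂) (∈-¬∈ at₂ at₀))))))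

¬•⊢τ• : ∀ G → ((¬ₚ (G •)) ∷ []) ⊢ₚ ((act G τ) • ∷ [])
¬•⊢τ• (var X ι) = ax
¬•⊢τ• (var X τ) = ¬L (¬R ax)
¬•⊢τ• (e one) = ¬L (⊆-R (_ ∷ []) (λ { (here refl) → at₀ }) oneR)
¬•⊢τ• (e two) = wkL oneR
¬•⊢τ• (q F G H) =
  by-cases
    (by-cases (¬∈-R at₂ (∨R₁ (∧R (∈-ax at₁ at₀) (∈-ax at₀ at₀))))
              (∨R₁ (∧R (∈-ax at₁ at₀) (cut-∈ (¬•⊢τ• G) at₀ (∈-ax at₀ at₀)))))
    (by-cases (¬∈-R at₂ (∨R₂ (∧R (∈-ax at₁ at₀) (∈-ax at₀ at₀))))
              (∨R₂ (∧R (∈-ax at₁ at₀) (cut-∈ (¬•⊢τ• H) at₀ (∈-ax at₀ at₀)))))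

τ•-L : ∀ G {Γ Δ} → Γ ⊢ₚ (G • ∷ Δ) → ((act G τ) • ∷ Γ) ⊢ₚ Δ
τ•-L G p = cut-∈ (τ•⊢¬• G) at₀ (¬L (⊆-L _ there p))

τ•-R : ∀ G {Γ Δ} → (G • ∷ Γ) ⊢ₚ Δ → Γ ⊢ₚ ((act G τ) • ∷ Δ)
τ•-R G p =
  cut (⊆-R _ (λ { (here refl) → at₀ ; (there m) → there (there m) }) (¬R p))
      (entail-∈ (¬•⊢τ• G) at₀)

q•-L : ∀ {F G H Γ Δ} → (G • ∷ F • ∷ Γ) ⊢ₚ Δ → (H • ∷ (act F τ) • ∷ Γ) ⊢ₚ Δ →
       (q F G H • ∷ Γ) ⊢ₚ Δ
q•-L {F} p r =
  ∨L (∧L (exch (↭-swap _ _ ↭-refl) ↭-refl p))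
     (∧L (cut-∈ (¬•⊢τ• F) at₀
       (⊆-L _ (λ { (here refl) → at₂
                 ; (there (here refl)) → at₀
                 ; (there (there m)) → there (there (there m)) }) r)))

q•-R : ∀ {F G H Γ Δ} → (F • ∷ Γ) ⊢ₚ (G • ∷ Δ) → ((act F τ) • ∷ Γ) ⊢ₚ (H • ∷ Δ) →
       Γ ⊢ₚ (q F G H • ∷ Δ)
q•-R {F} p r =
  by-cases (∨R₁ (∧R (∈-ax at₀ at₀) p))
           (∨R₂ (∧R (∈-ax at₀ at₀)
             (cut-∈ (¬•⊢τ• F) at₀
               (⊆-L _ (λ { (here refl) → at₀ ; (there m) → there (there m) }) r))))

⟦_⟧_ : List F2 → Two → List PF
⟦ Γ ⟧ i = (actL Γ (to₁ i)) •L

act-tr : ∀ G i j → act (act G (tr i j)) (to₁ i) ≡ act G (to₁ j)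
act-tr G i j = trans (act-act G (tr i j) (to₁ i)) (cong (act G) (to₁-tr i j))

⟦actL-tr⟧ : ∀ Γ i j → ⟦ actL Γ (tr i j) ⟧ i ≡ ⟦ Γ ⟧ j
⟦actL-tr⟧ [] i j = refl
⟦actL-tr⟧ (G ∷ Γ) i j = cong₂ _∷_ (cong _• (act-tr G i j)) (⟦actL-tr⟧ Γ i j)

τ•-L-reindex : ∀ {Γ Δ} F i j {A} → act (act F (to₁ i)) τ ≡ A →
  ⟦ actL Γ (tr i j) ⟧ i ⊢ₚ ((act F (to₁ i)) • ∷ ⟦ actL Δ (tr i j) ⟧ i) →
  (A • ∷ ⟦ Γ ⟧ j) ⊢ₚ ⟦ Δ ⟧ j
τ•-L-reindex {Γ} {Δ} F i j refl p =
  τ•-L (act F (to₁ i)) (subst₂ _⊢ₚ_ (⟦actL-tr⟧ Γ i j) (cong (_ ∷_) (⟦actL-tr⟧ Δ i j)) p)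

τ•-R-reindex : ∀ {Γ Δ} F i j {A} → act (act F (to₁ i)) τ ≡ A →
  ((act F (to₁ i)) • ∷ ⟦ actL Γ (tr i j) ⟧ i) ⊢ₚ ⟦ actL Δ (tr i j) ⟧ i →
  ⟦ Γ ⟧ j ⊢ₚ (A • ∷ ⟦ Δ ⟧ j)
τ•-R-reindex {Γ} {Δ} F i j refl p =
  τ•-R (act F (to₁ i)) (subst₂ _⊢ₚ_ (cong (_ ∷_) (⟦actL-tr⟧ Γ i j)) (⟦actL-tr⟧ Δ i j) p)

sound : ∀ {Γ Δ i} → Γ ⊢[ i ] Δ → ⟦ Γ ⟧ i ⊢ₚ ⟦ Δ ⟧ i
sound (Const {i = one}) = oneR
sound (Const {i = two}) = oneR
sound (Id {i} {π = π} {ρ} eq) with ≡-at-inv⇒≡ i π ρ eq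
... | refl = ax
sound (Sym {Γ} {Δ} {i} {j} p) =
  subst₂ _⊢ₚ_ (⟦actL-tr⟧ Γ i j) (⟦actL-tr⟧ Δ i j) (sound p)
sound (Neg1 {F = F} {i} {j} {k} i≢k p) =
  τ•-L-reindex F i j (act-act-≡ F (sym (trans (to₁-tr j k) (to₁-≢ i k i≢k)))) (sound p)
sound (Neg2 {F = F} {i} {j} {k} j≢k p) =
  τ•-L-reindex F i j (act-act-≡ F (sym (to₁-tr-≢ i j k j≢k))) (sound p)
sound (Neg3 {F = F} {i} {j} i≢j p) =
  τ•-R-reindex F i j (trans (act-act F (to₁ i) τ) (cong (act F) (sym (to₁-≢ i j i≢j))))
               (sound p)
sound (qL {Γ} {Δ} {F} {G₁} {G₂} {i} ps) = q•-L branch₁ branch₂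
  where
  branch₁ : ((act G₁ (to₁ i)) • ∷ F • ∷ ⟦ Γ ⟧ i) ⊢ₚ ⟦ Δ ⟧ i
  branch₁ = subst₂ _⊢ₚ_
    (cong₂ _∷_ (cong _• (act-tr G₁ one i))
               (cong₂ _∷_ (cong _• (act-ι F)) (⟦actL-tr⟧ Γ one i)))
    (⟦actL-tr⟧ Δ one i) (sound (ps one))
  branch₂ : ((act G₂ (to₁ i)) • ∷ (act F τ) • ∷ ⟦ Γ ⟧ i) ⊢ₚ ⟦ Δ ⟧ i
  branch₂ = subst₂ _⊢ₚ_
    (cong₂ _∷_ (cong _• (act-tr G₂ two i)) (cong (_ ∷_) (⟦actL-tr⟧ Γ two i)))
    (⟦actL-tr⟧ Δ two i) (sound (ps two))
sound (qR {Γ} {Δ} {F} {G₁} {G₂} {i} ps) = q•-R branch₁ branch₂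
  where
  branch₁ : (F • ∷ ⟦ Γ ⟧ i) ⊢ₚ ((act G₁ (to₁ i)) • ∷ ⟦ Δ ⟧ i)
  branch₁ = subst₂ _⊢ₚ_
    (cong₂ _∷_ (cong _• (act-ι F)) (⟦actL-tr⟧ Γ one i))
    (cong₂ _∷_ (cong _• (act-tr G₁ one i)) (⟦actL-tr⟧ Δ one i)) (sound (ps one))
  branch₂ : ((act F τ) • ∷ ⟦ Γ ⟧ i) ⊢ₚ ((act G₂ (to₁ i)) • ∷ ⟦ Δ ⟧ i)
  branch₂ = subst₂ _⊢ₚ_
    (cong (_ ∷_) (⟦actL-tr⟧ Γ two i))
    (cong₂ _∷_ (cong _• (act-tr G₂ two i)) (⟦actL-tr⟧ Δ two i)) (sound (ps two))
sound (Cut p r) = cut (sound p) (sound r)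
sound (WkL p) = wkL (sound p)
sound (WkR p) = wkR (sound p)
sound (CtrL p) = ctrL (sound p)
sound (CtrR p) = ctrR (sound p)
sound (Exch Γ↭Γ′ Δ↭Δ′ p) =
  exch (map⁺ _• (map⁺ _ Γ↭Γ′)) (map⁺ _• (map⁺ _ Δ↭Δ′)) (sound p)

lemma5p4 : (Γ Δ : List F2) → Γ ⊢[ two ] Δ →
    (actL Γ τ) •L ⊢ₚ (actL Δ τ) •L
lemma5p4 Γ Δ = sound
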